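{- Let $n\ge2$, let $\mathbf{d}_n=(d_1,\dots,d_n)$ be a degree sequence and $v\in[n]$. Then $$\mathbb{P}(\mathfrak{s}_n(v)>k)=\frac{1}{\langle n\rangle_k}\sum_{(i_1,\dots,i_k)\in J_{n,k}(v)}\prod_{j=1}^k d_{i_j},\qquad 1\le k\le n-1,$$ where $\langle n\rangle_k=\prod_{j=0}^{k-1}(n-j)$ and $J_{n,k}(v)=\{(j_1,\dots,j_k)\in([n]\setminus\{v\})^k: j_\ell\ne j_m\text{ for }\ell\ne m\}$.
   Context: A degree sequence is $(d_1,\dots,d_n)\in\mathbb{N}_0^n$ with $\sum_j d_j=n$. $F$ is uniform on $\mathfrak{F}(\mathbf{d}_n)=\{f:[n]\to[n]: |f^{ -1}(\{i\})|=d_i\ \forall i\}$. Six-length: $\mathfrak{s}_f(v)=\min\{k\in\mathbb{N}: f^{(k)}(v)\in\{f^{(j)}(v):0\le j\le k-1\}\}$ ($f^{(k)}$ the $k$-fold composition, $f^{(0)}=\mathrm{id}$); $\mathfrak{s}_n(v)=\mathfrak{s}_F(v)$. -}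

module Defs where

open import Data.Nat using (ℕ; zero; suc; _*_; _≡ᵇ_; _<ᵇ_)
open import Data.Nat.Properties using ()
open import Data.Bool using (Bool; true; false; not; _∧_)
open import Data.Fin using (Fin; zero; suc; toℕ)
open import Data.Fin.Properties using (_≟_)
open import Data.List using (List; []; _∷_; map; length; filterᵇ; allFin; upTo; concatMap; applyUpTo)
open import Data.Integer using (+_)
open import Data.Rational using (ℚ; 0ℚ; _/_)
open import Relation.Nullary.Decidable using (⌊_⌋)
open import Function using (_∘_)
open import Data.Nat.ListAction using (sum; product)
open import Data.Bool.ListAction using (all; any)

_==_ : ∀ {n} → Fin n → Fin n → Bool
i == j = ⌊ i ≟ j ⌋

allFuns : (m n : ℕ) → List (Fin m → Fin n)
allFuns zero    n = (λ ()) ∷ []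
allFuns (suc m) n =
  concatMap (λ (b : Fin n) → map (λ (g : Fin m → Fin n) → λ { zero → b ; (suc i) → g i }) (allFuns m n)) (allFin n)

preimageSize : ∀ {n} → (Fin n → Fin n) → Fin n → ℕ
preimageSize {n} f i = length (filterᵇ (λ j → f j == i) (allFin n))

hasDegrees : ∀ {n} → (Fin n → ℕ) → (Fin n → Fin n) → Bool
hasDegrees {n} d f = all (λ i → preimageSize f i ≡ᵇ d i) (allFin n)

𝔉 : ∀ {n} → (Fin n → ℕ) → List (Fin n → Fin n)
𝔉 {n} d = filterᵇ (hasDegrees d) (allFuns n n)

iter : ∀ {n} → (Fin n → Fin n) → ℕ → Fin n → Fin n
iter f zero    x = x
iter f (suc k) x = f (iter f k x)

repeatsAt : ∀ {n} → (Fin n → Fin n) → Fin n → ℕ → Bool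
repeatsAt f v k = any (λ j → iter f k v == iter f j v) (upTo k)

-- s_f(v) > k  :⇔  min{k' ≥ 1 : repeatsAt f v k'} > k
--              ⇔  no k' with 1 ≤ k' ≤ k satisfies repeatsAt f v k'
sixLengthGt : ∀ {n} → (Fin n → Fin n) → Fin n → ℕ → Bool
sixLengthGt f v k = not (any (repeatsAt f v) (applyUpTo suc k))

tuples : (n k : ℕ) → List (List (Fin n))
tuples n zero    = [] ∷ []
tuples n (suc k) = concatMap (λ i → map (i ∷_) (tuples n k)) (allFin n)

distinct : ∀ {n} → List (Fin n) → Bool
distinct []       = true
distinct (x ∷ xs) = all (λ y → not (x == y)) xs ∧ distinct xs

J : (n k : ℕ) → Fin n → List (List (Fin n))
J n k v = filterᵇ (λ t → all (λ i → not (i == v)) t ∧ distinct t) (tuples n k)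

falling : ℕ → ℕ → ℕ
falling n zero    = 1
falling zero (suc k) = 0
falling (suc n) (suc k) = suc n * falling n k

-- a / b as a rational (b = 0 never occurs in the statement; value 0 there)
ratio : ℕ → ℕ → ℚ
ratio a zero    = 0ℚ
ratio a (suc b) = (+ a) / suc b

-- P(s_n(v) > k) for F uniform on 𝔉(d)
probSixLengthGt : ∀ {n} → (Fin n → ℕ) → Fin n → ℕ → ℚ
probSixLengthGt d v k =
  ratio (length (filterᵇ (λ f → sixLengthGt f v k) (𝔉 d))) (length (𝔉 d))

Jsum : ∀ {n} → (Fin n → ℕ) → ℕ → Fin n → ℕ
Jsum {n} d k v = sum (map (λ t → product (map d t)) (J n k v))

-- A map f ∈ 𝔉(d) has 𝔰_f(v) > k exactly when its orbit v, f v, …, f^(k) v has no repetition, i.e.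
-- when the tuple t = (f v, …, f^(k) v) that f follows lies in J_{n,k}(v).  Following a fixed t
-- prescribes f at the k points v, t₁, …, t_{k-1}, and the remaining n − k points must realise the
-- residual degrees d − 𝟙_t; by the multinomial theorem there are (n − k)! / ∏ᵢ (dᵢ − 𝟙_t(i))! such
-- maps when d ≥ 𝟙_t, and none otherwise.  As |𝔉(d)| = n! / ∏ᵢ dᵢ! and
-- ∏ᵢ dᵢ! = ∏ᵢ (dᵢ − 𝟙_t(i))! · ∏ⱼ d_{tⱼ}, this count is |𝔉(d)| · ∏ⱼ d_{tⱼ} / ⟨n⟩_k in both cases;
-- summing over J_{n,k}(v) gives the formula.

module Submission where

open import Algebra.Bundles using (CommutativeMonoid)
open import Algebra.Core using (Op₂)
open import Algebra.Structures using (IsCommutativeMonoid)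
open import Data.Bool.Base using (Bool; true; false; not; _∧_; if_then_else_; T)
open import Data.Bool.ListAction using (all; any; and)
open import Data.Bool.Properties
  using (∧-isCommutativeMonoid; ∧-commutativeMonoid; ∧-conicalˡ; ∧-conicalʳ; ∧-assoc; ∧-comm; ∧-zeroʳ;
         ∧-identityʳ; ∨-identityʳ; T-≡)
open import Data.Fin using (Fin; zero; suc; punchIn)
open import Data.Fin.Properties using (_≟_; punchInᵢ≢i; all?; ¬∀⟶∃¬)
import Data.Integer as ℤ
open import Data.Integer.Properties using (pos-*)
open import Data.List
  using (List; []; _∷_; _++_; _∷ʳ_; map; foldr; tabulate; allFin; applyUpTo; upTo; length; filterᵇ;
         concatMap)
open import Data.List.Properties
  using (map-tabulate; map-cong; map-cong-local; map-++; map-∘; applyUpTo-∷ʳ; map-applyUpTo)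
open import Data.List.Relation.Unary.All as All using (All) renaming ([] to []ᴬ; _∷_ to _∷ᴬ_)
open import Data.List.Relation.Unary.All.Properties using (concat⁺; map⁺; all-filter; filter⁺)
open import Data.Maybe using (Maybe; just; nothing; is-nothing)
open import Data.Nat
  using (ℕ; zero; suc; _+_; _*_; _^_; _∸_; _≤_; _<_; _!; _≡ᵇ_; _≤?_; NonZero; z≤n; s≤s)
open import Data.Nat.ListAction using (sum; product)
open import Data.Nat.ListAction.Properties using (sum-++)
open import Data.Nat.Properties
  using (+-*-semiring; +-commutativeSemigroup; *-commutativeSemigroup; +-0-isCommutativeMonoid;
         *-1-isCommutativeMonoid; +-identityʳ; +-suc; +-cancelʳ-≡; m+n≡0⇒m≡0; *-comm; *-assoc;
         *-identityˡ; *-identityʳ; *-zeroʳ; *-distribˡ-+; *-cancelʳ-≡; m*n≢0; m*n≢0⇒m≢0; m*n≢0⇒n≢0;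
         _!≢0; ^-distribˡ-+-*; suc-injective; ≤-reflexive; ≤-trans; ≰⇒>; m∸n≤m; m+n∸n≡m; m∸n+n≡m)
open import Data.Product using (_×_; _,_)
open import Data.Rational.Properties using (fromℚᵘ-cong)
open import Data.Rational.Unnormalised using (mkℚᵘ; *≡*)
open import Data.Vec.Functional using (removeAt) renaming (_∷_ to _◂_)
open import Function using (_∘_; id)
open import Function.Bundles using (Equivalence)
open import Level using (0ℓ)
open import Relation.Binary.PropositionalEquality
  using (_≡_; _≢_; refl; sym; trans; cong; cong₂; subst; module ≡-Reasoning)
open import Relation.Nullary using (yes; no; contradiction)
open import Relation.Nullary.Decidable using (T?)

open import Algebra.Properties.Semiring.Sum +-*-semiring using (*-distribʳ-sum)
open import Algebra.Properties.CommutativeSemigroup +-commutativeSemigroup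
  using () renaming (interchange to +-interchange)
open import Algebra.Properties.CommutativeSemigroup *-commutativeSemigroup
  using () renaming (x∙yz≈y∙xz to x*yz≡y*xz; x∙yz≈xz∙y to x*yz≡xz*y; xy∙z≈xz∙y to xy*z≡xz*y)
open import Algebra.Properties.CommutativeSemigroup
  (CommutativeMonoid.commutativeSemigroup ∧-commutativeMonoid)
  using () renaming (interchange to ∧-interchange)

open import Defs

==-refl : ∀ {n} (i : Fin n) → (i == i) ≡ true
==-refl i with i ≟ i
... | yes _  = refl
... | no i≢i = contradiction refl i≢i

==⇒≡ : ∀ {n} {i j : Fin n} → (i == j) ≡ true → i ≡ j
==⇒≡ {i = i} {j} eq with i ≟ j
... | yes i≡j = i≡j

≢⇒==-false : ∀ {n} {i j : Fin n} → i ≢ j → (i == j) ≡ false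
≢⇒==-false {i = i} {j} i≢j with i ≟ j
... | yes i≡j = contradiction i≡j i≢j
... | no _    = refl

==-sym : ∀ {n} (i j : Fin n) → (i == j) ≡ (j == i)
==-sym i j with i ≟ j | j ≟ i
... | yes _   | yes _   = refl
... | no _    | no _    = refl
... | yes i≡j | no j≢i  = contradiction (sym i≡j) j≢i
... | no i≢j  | yes j≡i = contradiction (sym j≡i) i≢j

𝟙 : Bool → ℕ
𝟙 true  = 1
𝟙 false = 0

𝟙-∧ : ∀ a b → 𝟙 (a ∧ b) ≡ 𝟙 a * 𝟙 b
𝟙-∧ true  b = sym (+-identityʳ (𝟙 b))
𝟙-∧ false b = refl

-- Big operators over Fin

module FinFold {A : Set} {_∙_ : Op₂ A} {ε : A} (isCM : IsCommutativeMonoid _≡_ _∙_ ε) where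

  private
    M : CommutativeMonoid 0ℓ 0ℓ
    M = record { Carrier = A; _≈_ = _≡_; _∙_ = _∙_; ε = ε; isCommutativeMonoid = isCM }

  open IsCommutativeMonoid isCM using (identityʳ)
  open import Algebra.Properties.CommutativeSemigroup (CommutativeMonoid.commutativeSemigroup M) public
    using (x∙yz≈y∙xz)
  open import Algebra.Properties.CommutativeMonoid.Sum M public
    using () renaming (sum to ⨁; sum-remove to ⨁-remove; sum-cong-≗ to ⨁-cong;
                       sum-replicate-zero to ⨁-ε; ∑-distrib-+ to ⨁-distrib)

  foldr-tabulate : ∀ {n} (h : Fin n → A) → foldr _∙_ ε (tabulate h) ≡ ⨁ h
  foldr-tabulate {zero}  h = refl
  foldr-tabulate {suc n} h = cong (h zero ∙_) (foldr-tabulate (h ∘ suc))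

  foldr-map-allFin : ∀ {n} (h : Fin n → A) → foldr _∙_ ε (map h (allFin n)) ≡ ⨁ h
  foldr-map-allFin h = trans (cong (foldr _∙_ ε) (map-tabulate id h)) (foldr-tabulate h)

  ⨁-remove-≢ : ∀ {n} (b : Fin (suc n)) {g h : Fin (suc n) → A} →
               (∀ i → i ≢ b → g i ≡ h i) → ⨁ g ≡ g b ∙ ⨁ (removeAt h b)
  ⨁-remove-≢ b {g} agree =
    trans (⨁-remove {i = b} g) (cong (g b ∙_) (⨁-cong (λ j → agree (punchIn b j) (punchInᵢ≢i b j))))

  ⨁-δ : ∀ {n} (a : Fin n) (g : Bool → Fin n → A) → (∀ i → g false i ≡ ε) →
        ⨁ (λ i → g (a == i) i) ≡ g true a
  ⨁-δ {suc n} a g g-false = begin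
    ⨁ (λ i → g (a == i) i)                   ≡⟨ ⨁-remove-≢ a {h = λ _ → ε} off-a ⟩
    g (a == a) a ∙ ⨁ {n} (λ _ → ε)           ≡⟨ cong₂ (λ b s → g b a ∙ s) (==-refl a) (⨁-ε n) ⟩
    g true a ∙ ε                             ≡⟨ identityʳ (g true a) ⟩
    g true a                                 ∎
    where
      open ≡-Reasoning
      off-a : ∀ i → i ≢ a → g (a == i) i ≡ ε
      off-a i i≢a rewrite ≢⇒==-false (λ a≡i → i≢a (sym a≡i)) = g-false i

module Σᶠ = FinFold +-0-isCommutativeMonoid

module Πᶠ = FinFold *-1-isCommutativeMonoid

module ⋀ᶠ = FinFold ∧-isCommutativeMonoid

Σᶠ-δ : ∀ {n} (a : Fin n) (h : Fin n → ℕ) → Σᶠ.⨁ (λ i → 𝟙 (a == i) * h i) ≡ h a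
Σᶠ-δ a h = trans (Σᶠ.⨁-δ a (λ b i → 𝟙 b * h i) (λ _ → refl)) (*-identityˡ (h a))

Πᶠ-δ : ∀ {n} (a : Fin n) (h : Fin n → ℕ) → Πᶠ.⨁ (λ i → h i ^ 𝟙 (a == i)) ≡ h a
Πᶠ-δ a h = trans (Πᶠ.⨁-δ a (λ b i → h i ^ 𝟙 b) (λ _ → refl)) (*-identityʳ (h a))

Σᶠ≡0⇒≡0 : ∀ {n} (r : Fin n → ℕ) → Σᶠ.⨁ r ≡ 0 → ∀ i → r i ≡ 0
Σᶠ≡0⇒≡0 {suc n} r Σr≡0 i = m+n≡0⇒m≡0 (r i) (trans (sym (Σᶠ.⨁-remove {i = i} r)) Σr≡0)

Σᶠ-1 : ∀ n → Σᶠ.⨁ {n} (λ _ → 1) ≡ n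
Σᶠ-1 zero    = refl
Σᶠ-1 (suc n) = cong suc (Σᶠ-1 n)

⋀ᶠ-true : ∀ {n} (p : Fin n → Bool) → ⋀ᶠ.⨁ p ≡ true → ∀ i → p i ≡ true
⋀ᶠ-true {suc n} p ⋀p i = ∧-conicalˡ (p i) _ (trans (sym (⋀ᶠ.⨁-remove {i = i} p)) ⋀p)

⋀ᶠ-false : ∀ {n} (p : Fin n → Bool) (i : Fin n) → p i ≡ false → ⋀ᶠ.⨁ p ≡ false
⋀ᶠ-false {suc n} p i pi≡false = trans (⋀ᶠ.⨁-remove {i = i} p) (cong (_∧ ⋀ᶠ.⨁ (removeAt p i)) pi≡false)

module _ {A : Set} where

  ∑ : (A → ℕ) → List A → ℕ
  ∑ h xs = sum (map h xs)

  count : (A → Bool) → List A → ℕ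
  count p = ∑ (𝟙 ∘ p)

  length-filterᵇ : ∀ (p : A → Bool) xs → length (filterᵇ p xs) ≡ count p xs
  length-filterᵇ p []       = refl
  length-filterᵇ p (x ∷ xs) with p x
  ... | true  = cong suc (length-filterᵇ p xs)
  ... | false = length-filterᵇ p xs

  ∑-cong : ∀ {h g : A → ℕ} → (∀ x → h x ≡ g x) → ∀ xs → ∑ h xs ≡ ∑ g xs
  ∑-cong h≗g xs = cong sum (map-cong h≗g xs)

  count-cong : ∀ {p q : A → Bool} → (∀ x → p x ≡ q x) → ∀ xs → count p xs ≡ count q xs
  count-cong p≗q = ∑-cong (cong 𝟙 ∘ p≗q)

  ∑-++ : ∀ (h : A → ℕ) xs ys → ∑ h (xs ++ ys) ≡ ∑ h xs + ∑ h ys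
  ∑-++ h xs ys = trans (cong sum (map-++ h xs ys)) (sum-++ (map h xs) (map h ys))

  ∑-0 : ∀ xs → ∑ (λ _ → 0) xs ≡ 0
  ∑-0 []       = refl
  ∑-0 (_ ∷ xs) = ∑-0 xs

  ∑-*ˡ : ∀ c (h : A → ℕ) xs → ∑ (λ x → c * h x) xs ≡ c * ∑ h xs
  ∑-*ˡ c h []       = sym (*-zeroʳ c)
  ∑-*ˡ c h (x ∷ xs) = trans (cong (c * h x +_) (∑-*ˡ c h xs)) (sym (*-distribˡ-+ c (h x) _))

  ∑-+ : ∀ (h g : A → ℕ) xs → ∑ (λ x → h x + g x) xs ≡ ∑ h xs + ∑ g xs
  ∑-+ h g []       = refl
  ∑-+ h g (x ∷ xs) = trans (cong (h x + g x +_) (∑-+ h g xs)) (+-interchange (h x) (g x) _ _)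

  count-∧ : ∀ b (p : A → Bool) xs → count (λ x → b ∧ p x) xs ≡ 𝟙 b * count p xs
  count-∧ true  p xs = sym (+-identityʳ _)
  count-∧ false p xs = ∑-0 xs

  count-filterᵇ : ∀ (p q : A → Bool) xs → count q (filterᵇ p xs) ≡ count (λ x → p x ∧ q x) xs
  count-filterᵇ p q []       = refl
  count-filterᵇ p q (x ∷ xs) with p x
  ... | true  = cong (𝟙 (q x) +_) (count-filterᵇ p q xs)
  ... | false = count-filterᵇ p q xs

module _ {A B : Set} where

  ∑-map : ∀ (h : B → ℕ) (F : A → B) xs → ∑ h (map F xs) ≡ ∑ (h ∘ F) xs
  ∑-map h F xs = cong sum (sym (map-∘ xs))

  ∑-concatMap : ∀ (h : B → ℕ) (F : A → List B) xs → ∑ h (concatMap F xs) ≡ ∑ (∑ h ∘ F) xs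
  ∑-concatMap h F []       = refl
  ∑-concatMap h F (x ∷ xs) =
    trans (∑-++ h (F x) (concatMap F xs)) (cong (∑ h (F x) +_) (∑-concatMap h F xs))

  ∑-comm : ∀ (g : A → B → ℕ) xs ys → ∑ (λ x → ∑ (g x) ys) xs ≡ ∑ (λ y → ∑ (λ x → g x y) xs) ys
  ∑-comm g []       ys = sym (∑-0 ys)
  ∑-comm g (x ∷ xs) ys = trans (cong (∑ (g x) ys +_) (∑-comm g xs ys)) (sym (∑-+ (g x) _ ys))

∑-*ʳ : ∀ {A : Set} c (h : A → ℕ) xs → ∑ (λ x → h x * c) xs ≡ ∑ h xs * c
∑-*ʳ c h xs = trans (∑-cong (λ x → *-comm (h x) c) xs) (trans (∑-*ˡ c h xs) (*-comm c (∑ h xs)))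

∑-cong-All : ∀ {A : Set} {h g : A → ℕ} {xs} → All (λ x → h x ≡ g x) xs → ∑ h xs ≡ ∑ g xs
∑-cong-All h≗g = cong sum (map-cong-local h≗g)

count-concatMap-map : ∀ {A B : Set} {n} (p : B → Bool) (F : Fin n → A → B) (L : List A) →
                      count p (concatMap (λ b → map (F b) L) (allFin n)) ≡
                      Σᶠ.⨁ (λ b → count (p ∘ F b) L)
count-concatMap-map {n = n} p F L =
  trans (∑-concatMap (𝟙 ∘ p) (λ b → map (F b) L) (allFin n))
        (trans (∑-cong (λ b → ∑-map (𝟙 ∘ p) (F b) L) (allFin n))
               (Σᶠ.foldr-map-allFin (λ b → count (p ∘ F b) L)))

≡ᵇ-∸ : ∀ e x d → e ≤ d → ((e + x) ≡ᵇ d) ≡ (x ≡ᵇ (d ∸ e))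
≡ᵇ-∸ zero    x d       z≤n       = refl
≡ᵇ-∸ (suc e) x (suc d) (s≤s e≤d) = ≡ᵇ-∸ e x d e≤d

<⇒+≡ᵇ-false : ∀ {d e} x → d < e → ((e + x) ≡ᵇ d) ≡ false
<⇒+≡ᵇ-false {zero}  {suc e} x _         = refl
<⇒+≡ᵇ-false {suc d} {suc e} x (s≤s d<e) = <⇒+≡ᵇ-false x d<e

factorials : ∀ {n} → (Fin n → ℕ) → ℕ
factorials r = Πᶠ.⨁ (λ i → r i !)

factorials-nonZero : ∀ {n} (r : Fin n → ℕ) → NonZero (factorials r)
factorials-nonZero {zero}  r = _
factorials-nonZero {suc n} r = m*n≢0 (r zero !) _ {{r zero !≢0}} {{factorials-nonZero (r ∘ suc)}}

!-split : ∀ a e → e ≤ 1 → e ≤ a → a ! ≡ (a ∸ e) ! * a ^ e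
!-split a       zero       _ _ = sym (*-identityʳ (a !))
!-split (suc a) (suc zero) _ _ = trans (*-comm (suc a) (a !)) (cong (a ! *_) (sym (*-identityʳ (suc a))))
!-split _       (suc (suc _)) (s≤s ()) _

falling-factorial : ∀ n k → k ≤ n → (n ∸ k) ! * falling n k ≡ n !
falling-factorial n       zero    _         = *-identityʳ (n !)
falling-factorial (suc n) (suc k) (s≤s k≤n) =
  trans (x*yz≡y*xz ((n ∸ k) !) (suc n) (falling n k)) (cong (suc n *_) (falling-factorial n k k≤n))

falling-nonZero : ∀ n k → k ≤ n → NonZero (falling n k)
falling-nonZero n k k≤n =
  m*n≢0⇒n≢0 ((n ∸ k) !) {{subst NonZero (sym (falling-factorial n k k≤n)) (n !≢0)}}

-- `ratio a (suc b)` normalises the unnormalised fraction `mkℚᵘ (+ a) b`.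
ratio-cross : ∀ a b c e .{{_ : NonZero b}} .{{_ : NonZero e}} → a * e ≡ c * b → ratio a b ≡ ratio c e
ratio-cross a (suc b) c (suc e) a*e≡c*b = fromℚᵘ-cong {mkℚᵘ (ℤ.+ a) b} {mkℚᵘ (ℤ.+ c) e}
  (*≡* (trans (sym (pos-* a (suc e))) (trans (cong ℤ.+_ a*e≡c*b) (pos-* c (suc b)))))

decrementAt : ∀ {n} → (Fin n → ℕ) → Fin n → Fin n → ℕ
decrementAt r b i = r i ∸ 𝟙 (b == i)

decrementAt-≢ : ∀ {n} (r : Fin n → ℕ) {b} i → i ≢ b → r i ≡ decrementAt r b i
decrementAt-≢ r {b} i i≢b rewrite ≢⇒==-false {i = b} {i} (λ b≡i → i≢b (sym b≡i)) = refl

decrementAt-self : ∀ {n} (r : Fin n → ℕ) b {q} → r b ≡ suc q → decrementAt r b b ≡ q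
decrementAt-self r b rb≡1+q rewrite ==-refl b = cong (_∸ 1) rb≡1+q

𝟙==≤ : ∀ {n} (r : Fin n → ℕ) b {q} → r b ≡ suc q → ∀ i → 𝟙 (b == i) ≤ r i
𝟙==≤ r b rb≡1+q i with b ≟ i
... | yes refl = subst (1 ≤_) (sym rb≡1+q) (s≤s z≤n)
... | no _     = z≤n

Σᶠ-decrementAt : ∀ {n} (r : Fin n → ℕ) b {q} → r b ≡ suc q → Σᶠ.⨁ r ≡ suc (Σᶠ.⨁ (decrementAt r b))
Σᶠ-decrementAt {suc n} r b {q} rb≡1+q = begin
  Σᶠ.⨁ r             ≡⟨ Σᶠ.⨁-remove-≢ b (decrementAt-≢ r) ⟩
  r b + R            ≡⟨ cong (_+ R) rb≡1+q ⟩
  suc q + R          ≡⟨ cong (λ m → suc m + R) (sym (decrementAt-self r b rb≡1+q)) ⟩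
  suc (r′ b + R)     ≡⟨ cong suc (sym (Σᶠ.⨁-remove {i = b} r′)) ⟩
  suc (Σᶠ.⨁ r′)      ∎
  where
    open ≡-Reasoning
    r′ = decrementAt r b
    R = Σᶠ.⨁ (removeAt r′ b)

factorials-decrementAt : ∀ {n} (r : Fin n → ℕ) b {q} → r b ≡ suc q →
                         factorials r ≡ suc q * factorials (decrementAt r b)
factorials-decrementAt {suc n} r b {q} rb≡1+q = begin
  factorials r            ≡⟨ Πᶠ.⨁-remove-≢ b (λ i i≢b → cong _! (decrementAt-≢ r i i≢b)) ⟩
  r b ! * P               ≡⟨ cong (λ m → m ! * P) rb≡1+q ⟩
  suc q * q ! * P         ≡⟨ *-assoc (suc q) (q !) P ⟩
  suc q * (q ! * P)       ≡⟨ cong (λ m → suc q * (m ! * P)) (sym (decrementAt-self r b rb≡1+q)) ⟩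
  suc q * (r′ b ! * P)    ≡⟨ cong (suc q *_) (sym (Πᶠ.⨁-remove {i = b} (λ i → r′ i !))) ⟩
  suc q * factorials r′   ∎
  where
    open ≡-Reasoning
    r′ = decrementAt r b
    P = Πᶠ.⨁ (removeAt (λ i → r′ i !) b)

-- Counting maps with prescribed values

-- `c x = just y` prescribes the value y at x; the points x with `c x = nothing` are free.
Constraint : ℕ → ℕ → Set
Constraint m n = Fin m → Maybe (Fin n)

agrees : ∀ {n} → Maybe (Fin n) → Fin n → Bool
agrees nothing  _ = true
agrees (just y) z = y == z

module _ {m n : ℕ} (c : Constraint m n) where

  respects : (Fin m → Fin n) → Bool
  respects f = ⋀ᶠ.⨁ (λ x → agrees (c x) (f x))

  #free : ℕ
  #free = Σᶠ.⨁ (λ x → 𝟙 (is-nothing (c x)))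

  freeFibre : (Fin m → Fin n) → Fin n → ℕ
  freeFibre f i = Σᶠ.⨁ (λ x → 𝟙 (is-nothing (c x) ∧ f x == i))

  fits : (Fin n → ℕ) → (Fin m → Fin n) → Bool
  fits r f = respects f ∧ ⋀ᶠ.⨁ (λ i → freeFibre f i ≡ᵇ r i)

-- `allFuns` extends g by b with its own pattern lambda, which `fits c r` cannot tell apart from
-- `b ◂ g`: it only ever applies its argument to `zero` and to `suc x`.
count-allFuns-suc : ∀ {m n} (c : Constraint (suc m) n) r →
                    count (fits c r) (allFuns (suc m) n) ≡
                    Σᶠ.⨁ (λ b → count (fits c r ∘ (b ◂_)) (allFuns m n))
count-allFuns-suc {m} {n} c r = count-concatMap-map {n = n} (fits c r) _ (allFuns m n)

count-prescribed-head : ∀ {m n} y (c : Constraint m n) r →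
                        count (fits (just y ◂ c) r) (allFuns (suc m) n) ≡ count (fits c r) (allFuns m n)
count-prescribed-head {m} {n} y c r = begin
  count (fits (just y ◂ c) r) (allFuns (suc m) n)
    ≡⟨ count-allFuns-suc (just y ◂ c) r ⟩
  Σᶠ.⨁ (λ b → count (fits (just y ◂ c) r ∘ (b ◂_)) L)
    ≡⟨ Σᶠ.⨁-cong (λ b → trans (count-cong (λ g → ∧-assoc (y == b) (respects c g) _) L)
                              (count-∧ (y == b) (fits c r) L)) ⟩
  Σᶠ.⨁ (λ b → 𝟙 (y == b) * count (fits c r) L)
    ≡⟨ Σᶠ-δ y (λ _ → count (fits c r) L) ⟩
  count (fits c r) L
    ∎
  where
    open ≡-Reasoning
    L = allFuns m n

module _ {m n} (c : Constraint m n) (r : Fin n → ℕ) (b : Fin n) (g : Fin m → Fin n) where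

  fits-free-head-0 : r b ≡ 0 → fits (nothing ◂ c) r (b ◂ g) ≡ false
  fits-free-head-0 rb≡0 =
    trans (cong (respects c g ∧_) (⋀ᶠ-false _ b at-b)) (∧-zeroʳ (respects c g))
    where
      at-b : ((𝟙 (b == b) + freeFibre c g b) ≡ᵇ r b) ≡ false
      at-b = cong₂ (λ e k → (𝟙 e + freeFibre c g b) ≡ᵇ k) (==-refl b) rb≡0

  fits-free-head : ∀ {q} → r b ≡ suc q → fits (nothing ◂ c) r (b ◂ g) ≡ fits c (decrementAt r b) g
  fits-free-head rb≡1+q = cong (respects c g ∧_) (⋀ᶠ.⨁-cong λ i →
    ≡ᵇ-∸ (𝟙 (b == i)) (freeFibre c g i) (r i) (𝟙==≤ r b rb≡1+q i))

multinomial : ∀ {n} m (c : Constraint m n) (r : Fin n → ℕ) → Σᶠ.⨁ r ≡ #free c →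
              count (fits c r) (allFuns m n) * factorials r ≡ #free c !
multinomial {n} zero c r Σr≡0 = cong₂ (λ b p → (𝟙 b + 0) * p) all-0≡r factorials≡1
  where
    r≡0 = Σᶠ≡0⇒≡0 r Σr≡0
    all-0≡r : ⋀ᶠ.⨁ (λ i → 0 ≡ᵇ r i) ≡ true
    all-0≡r = trans (⋀ᶠ.⨁-cong (λ i → cong (0 ≡ᵇ_) (r≡0 i))) (⋀ᶠ.⨁-ε n)
    factorials≡1 : factorials r ≡ 1
    factorials≡1 = trans (Πᶠ.⨁-cong (λ i → cong _! (r≡0 i))) (Πᶠ.⨁-ε n)
-- Both sides inspect c only at zero and at suc x, so c may be split as c zero ◂ c ∘ suc.
multinomial {n} (suc m) c r Σr≡#free = step (c zero) (c ∘ suc) Σr≡#free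
  where
    open ≡-Reasoning
    L = allFuns m n
    step : ∀ c₀ c′ → Σᶠ.⨁ r ≡ #free (c₀ ◂ c′) →
           count (fits (c₀ ◂ c′) r) (allFuns (suc m) n) * factorials r ≡ #free (c₀ ◂ c′) !
    step (just y) c′ Σr≡#free =
      trans (cong (_* factorials r) (count-prescribed-head y c′ r)) (multinomial m c′ r Σr≡#free)
    step nothing c′ Σr≡1+#free = begin
      count (fits (nothing ◂ c′) r) (allFuns (suc m) n) * factorials r
        ≡⟨ cong (_* factorials r) (count-allFuns-suc (nothing ◂ c′) r) ⟩
      Σᶠ.⨁ (λ b → count (fits (nothing ◂ c′) r ∘ (b ◂_)) L) * factorials r
        ≡⟨ *-distribʳ-sum (factorials r) (λ b → count (fits (nothing ◂ c′) r ∘ (b ◂_)) L) ⟩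
      Σᶠ.⨁ (λ b → count (fits (nothing ◂ c′) r ∘ (b ◂_)) L * factorials r)
        ≡⟨ Σᶠ.⨁-cong head-value ⟩
      Σᶠ.⨁ (λ b → r b * #free c′ !)
        ≡⟨ sym (*-distribʳ-sum (#free c′ !) r) ⟩
      Σᶠ.⨁ r * #free c′ !
        ≡⟨ cong (_* #free c′ !) Σr≡1+#free ⟩
      suc (#free c′) !
        ∎
      where
        head-value : ∀ b → count (fits (nothing ◂ c′) r ∘ (b ◂_)) L * factorials r ≡ r b * #free c′ !
        head-value b with r b in rb
        ... | zero  = cong (_* factorials r)
                        (trans (count-cong (λ g → fits-free-head-0 c′ r b g rb) L) (∑-0 L))
        ... | suc q = begin
          count (fits (nothing ◂ c′) r ∘ (b ◂_)) L * factorials r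
            ≡⟨ cong₂ _*_ (count-cong (λ g → fits-free-head c′ r b g rb) L)
                         (factorials-decrementAt r b rb) ⟩
          count (fits c′ r′) L * (suc q * factorials r′)
            ≡⟨ x*yz≡y*xz (count (fits c′ r′) L) (suc q) (factorials r′) ⟩
          suc q * (count (fits c′ r′) L * factorials r′)
            ≡⟨ cong (suc q *_) (multinomial m c′ r′ Σr′≡#free) ⟩
          suc q * #free c′ !
            ∎
          where
            r′ = decrementAt r b
            Σr′≡#free = suc-injective (trans (sym (Σᶠ-decrementAt r b rb)) Σr≡1+#free)

-- Path constraints

pathConstraint : ∀ {n} → Fin n → List (Fin n) → Constraint n n
pathConstraint x []      z = nothing
pathConstraint x (y ∷ t) z = if z == x then just y else pathConstraint y t z

follows : ∀ {n} → (Fin n → Fin n) → Fin n → List (Fin n) → Bool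
follows f x []      = true
follows f x (y ∷ t) = (y == f x) ∧ follows f y t

distinct-head : ∀ {n} (x : Fin n) t → distinct (x ∷ t) ≡ true → all (λ y → not (x == y)) t ≡ true
distinct-head x t = ∧-conicalˡ _ (distinct t)

distinct-tail : ∀ {n} (x : Fin n) t → distinct (x ∷ t) ≡ true → distinct t ≡ true
distinct-tail x t = ∧-conicalʳ (all (λ y → not (x == y)) t) _

pathConstraint-∉ : ∀ {n} (z x : Fin n) t → all (λ w → not (z == w)) (x ∷ t) ≡ true →
                   pathConstraint x t z ≡ nothing
pathConstraint-∉ z x []      z∉ = refl
pathConstraint-∉ z x (y ∷ t) z∉ with z == x
... | false = pathConstraint-∉ z y t z∉

module _ {A : Set} {_∙_ : Op₂ A} {ε : A} (isCM : IsCommutativeMonoid _≡_ _∙_ ε) where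
  open FinFold isCM

  -- Stated without cancelling φ x nothing, so that it also applies when free points are counted.
  ⨁-pathConstraint : ∀ {n} (φ : Fin n → Maybe (Fin n) → A) x y t →
                     all (λ w → not (x == w)) (y ∷ t) ≡ true →
                     φ x nothing ∙ ⨁ (λ z → φ z (pathConstraint x (y ∷ t) z)) ≡
                     φ x (just y) ∙ ⨁ (λ z → φ z (pathConstraint y t z))
  ⨁-pathConstraint {suc n} φ x y t x∉ = begin
    φ x nothing ∙ ⨁ φ-before            ≡⟨ cong (φ x nothing ∙_) (⨁-remove-≢ x {φ-before} agree) ⟩
    φ x nothing ∙ (φ-before x ∙ R)      ≡⟨ cong (λ a → φ x nothing ∙ (a ∙ R)) before-at-x ⟩
    φ x nothing ∙ (φ x (just y) ∙ R)    ≡⟨ x∙yz≈y∙xz (φ x nothing) (φ x (just y)) R ⟩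
    φ x (just y) ∙ (φ x nothing ∙ R)    ≡⟨ cong (λ a → φ x (just y) ∙ (a ∙ R)) after-at-x ⟩
    φ x (just y) ∙ (φ-after x ∙ R)      ≡⟨ cong (φ x (just y) ∙_) (sym (⨁-remove {i = x} φ-after)) ⟩
    φ x (just y) ∙ ⨁ φ-after            ∎
    where
      open ≡-Reasoning
      φ-before = λ z → φ z (pathConstraint x (y ∷ t) z)
      φ-after  = λ z → φ z (pathConstraint y t z)
      R = ⨁ (removeAt φ-after x)
      before-at-x : φ-before x ≡ φ x (just y)
      before-at-x = cong (λ b → φ x (if b then just y else pathConstraint y t x)) (==-refl x)
      after-at-x : φ x nothing ≡ φ-after x
      after-at-x = cong (φ x) (sym (pathConstraint-∉ x y t x∉))
      agree : ∀ z → z ≢ x → φ-before z ≡ φ-after z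
      agree z z≢x rewrite ≢⇒==-false z≢x = refl

respects-path : ∀ {n} (f : Fin n → Fin n) x t → distinct (x ∷ t) ≡ true →
                respects (pathConstraint x t) f ≡ follows f x t
respects-path {n} f x []      _   = ⋀ᶠ.⨁-ε n
respects-path     f x (y ∷ t) xyt = begin
  respects (pathConstraint x (y ∷ t)) f
    ≡⟨ ⨁-pathConstraint ∧-isCommutativeMonoid (λ z m → agrees m (f z)) x y t
                        (distinct-head x (y ∷ t) xyt) ⟩
  (y == f x) ∧ respects (pathConstraint y t) f
    ≡⟨ cong ((y == f x) ∧_) (respects-path f y t (distinct-tail x (y ∷ t) xyt)) ⟩
  follows f x (y ∷ t)
    ∎
  where open ≡-Reasoning

#free-path : ∀ {n} (x : Fin n) t → distinct (x ∷ t) ≡ true → #free (pathConstraint x t) + length t ≡ n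
#free-path {n} x []      _   = trans (+-identityʳ _) (Σᶠ-1 n)
#free-path {n} x (y ∷ t) xyt = begin
  #free (pathConstraint x (y ∷ t)) + suc (length t)
    ≡⟨ +-suc _ (length t) ⟩
  suc (#free (pathConstraint x (y ∷ t))) + length t
    ≡⟨ cong (_+ length t) (⨁-pathConstraint +-0-isCommutativeMonoid (λ z m → 𝟙 (is-nothing m)) x y t
                             (distinct-head x (y ∷ t) xyt)) ⟩
  #free (pathConstraint y t) + length t
    ≡⟨ #free-path y t (distinct-tail x (y ∷ t) xyt) ⟩
  n ∎
  where open ≡-Reasoning

prescribes : ∀ {n} → Maybe (Fin n) → Fin n → Bool
prescribes nothing  _ = false
prescribes (just y) i = y == i

prescribedFibre : ∀ {m n} → Constraint m n → Fin n → ℕ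
prescribedFibre c i = Σᶠ.⨁ (λ x → 𝟙 (prescribes (c x) i))

prescribedFibre-path : ∀ {n} (x : Fin n) t → distinct (x ∷ t) ≡ true →
                       ∀ i → prescribedFibre (pathConstraint x t) i ≡ count (_== i) t
prescribedFibre-path {n} x []      _   i = Σᶠ.⨁-ε n
prescribedFibre-path     x (y ∷ t) xyt i =
  trans (⨁-pathConstraint +-0-isCommutativeMonoid (λ z m → 𝟙 (prescribes m i)) x y t
                          (distinct-head x (y ∷ t) xyt))
        (cong (𝟙 (y == i) +_) (prescribedFibre-path y t (distinct-tail x (y ∷ t) xyt) i))

fibre : ∀ {m n} → (Fin m → Fin n) → Fin n → ℕ
fibre f i = Σᶠ.⨁ (λ x → 𝟙 (f x == i))

hasDegrees-fibre : ∀ {n} (d : Fin n → ℕ) f → hasDegrees d f ≡ ⋀ᶠ.⨁ (λ i → fibre f i ≡ᵇ d i)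
hasDegrees-fibre {n} d f = trans (⋀ᶠ.foldr-map-allFin (λ i → preimageSize f i ≡ᵇ d i)) (⋀ᶠ.⨁-cong λ i →
  cong (_≡ᵇ d i) (trans (length-filterᵇ (λ j → f j == i) (allFin n))
                        (Σᶠ.foldr-map-allFin (λ j → 𝟙 (f j == i)))))

fibre-split : ∀ {m n} (c : Constraint m n) f → respects c f ≡ true →
              ∀ i → fibre f i ≡ prescribedFibre c i + freeFibre c f i
fibre-split c f respects-c i =
  trans (Σᶠ.⨁-cong (λ x → split (c x) (⋀ᶠ-true _ respects-c x)))
        (Σᶠ.⨁-distrib (λ x → 𝟙 (prescribes (c x) i)) (λ x → 𝟙 (is-nothing (c x) ∧ f x == i)))
  where
    split : ∀ {x} m → agrees m (f x) ≡ true →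
            𝟙 (f x == i) ≡ 𝟙 (prescribes m i) + 𝟙 (is-nothing m ∧ f x == i)
    split nothing  _    = refl
    split (just y) y≡fx rewrite ==⇒≡ y≡fx = sym (+-identityʳ _)

occurrences-total : ∀ {n} (t : List (Fin n)) → Σᶠ.⨁ (λ i → count (_== i) t) ≡ length t
occurrences-total {n} []      = Σᶠ.⨁-ε n
occurrences-total     (y ∷ t) =
  trans (Σᶠ.⨁-distrib (λ i → 𝟙 (y == i)) (λ i → count (_== i) t))
        (cong₂ _+_ (Σᶠ.⨁-δ y (λ b _ → 𝟙 b) (λ _ → refl)) (occurrences-total t))

count-∉ : ∀ {n} (y : Fin n) t → all (λ w → not (y == w)) t ≡ true → count (_== y) t ≡ 0
count-∉ y []      _  = refl
count-∉ y (w ∷ t) y∉ with y == w in y==w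
... | false = cong₂ _+_ (cong 𝟙 (trans (==-sym w y) y==w)) (count-∉ y t y∉)

occurrences≤1 : ∀ {n} (t : List (Fin n)) → distinct t ≡ true → ∀ i → count (_== i) t ≤ 1
occurrences≤1 []      _  i = z≤n
occurrences≤1 (y ∷ t) yt i with y == i in y==i
... | true  = subst (λ j → suc (count (_== j) t) ≤ 1) (==⇒≡ y==i)
                    (s≤s (≤-reflexive (count-∉ y t (distinct-head y t yt))))
... | false = occurrences≤1 t (distinct-tail y t yt) i

Πᶠ-power-occurrences : ∀ {n} (d : Fin n → ℕ) t → Πᶠ.⨁ (λ i → d i ^ count (_== i) t) ≡ product (map d t)
Πᶠ-power-occurrences {n} d []      = Πᶠ.⨁-ε n
Πᶠ-power-occurrences     d (y ∷ t) = begin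
  Πᶠ.⨁ (λ i → d i ^ (𝟙 (y == i) + count (_== i) t))
    ≡⟨ Πᶠ.⨁-cong (λ i → ^-distribˡ-+-* (d i) (𝟙 (y == i)) (count (_== i) t)) ⟩
  Πᶠ.⨁ (λ i → d i ^ 𝟙 (y == i) * d i ^ count (_== i) t)
    ≡⟨ Πᶠ.⨁-distrib (λ i → d i ^ 𝟙 (y == i)) (λ i → d i ^ count (_== i) t) ⟩
  Πᶠ.⨁ (λ i → d i ^ 𝟙 (y == i)) * Πᶠ.⨁ (λ i → d i ^ count (_== i) t)
    ≡⟨ cong₂ _*_ (Πᶠ-δ y d) (Πᶠ-power-occurrences d t) ⟩
  d y * product (map d t)
    ∎
  where open ≡-Reasoning

factorials-split : ∀ {n} (d : Fin n → ℕ) t → distinct t ≡ true → (∀ i → count (_== i) t ≤ d i) →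
                   factorials d ≡ factorials (λ i → d i ∸ count (_== i) t) * product (map d t)
factorials-split d t t-distinct occ≤d = begin
  Πᶠ.⨁ (λ i → d i !)
    ≡⟨ Πᶠ.⨁-cong (λ i → !-split (d i) (count (_== i) t) (occurrences≤1 t t-distinct i) (occ≤d i)) ⟩
  Πᶠ.⨁ (λ i → (d i ∸ count (_== i) t) ! * d i ^ count (_== i) t)
    ≡⟨ Πᶠ.⨁-distrib (λ i → (d i ∸ count (_== i) t) !) (λ i → d i ^ count (_== i) t) ⟩
  factorials (λ i → d i ∸ count (_== i) t) * Πᶠ.⨁ (λ i → d i ^ count (_== i) t)
    ≡⟨ cong (factorials (λ i → d i ∸ count (_== i) t) *_) (Πᶠ-power-occurrences d t) ⟩
  factorials (λ i → d i ∸ count (_== i) t) * product (map d t)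
    ∎
  where open ≡-Reasoning

product-overfull : ∀ {n} (d : Fin n → ℕ) t → distinct t ≡ true → ∀ i → d i < count (_== i) t →
                   product (map d t) ≡ 0
product-overfull {suc n} d t t-distinct i di<occ = begin
  product (map d t)                           ≡⟨ sym (Πᶠ-power-occurrences d t) ⟩
  Πᶠ.⨁ (λ j → d j ^ count (_== j) t)          ≡⟨ Πᶠ.⨁-remove {i = i} (λ j → d j ^ count (_== j) t) ⟩
  d i ^ count (_== i) t * rest                ≡⟨ cong (_* rest) (zero-power (d i) _ di<occ occ≤1) ⟩
  0                                           ∎
  where
    open ≡-Reasoning
    zero-power : ∀ a e → a < e → e ≤ 1 → a ^ e ≡ 0
    zero-power zero    (suc zero)    _         _        = refl
    zero-power (suc _) (suc zero)    (s≤s ())  _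
    zero-power _       (suc (suc _)) _         (s≤s ())
    rest = Πᶠ.⨁ (removeAt (λ j → d j ^ count (_== j) t) i)
    occ≤1 = occurrences≤1 t t-distinct i

#following : ∀ {n} → (Fin n → ℕ) → Fin n → List (Fin n) → ℕ
#following {n} d v t = count (λ f → hasDegrees d f ∧ follows f v t) (allFuns n n)

module _ {n} (d : Fin n → ℕ) (v : Fin n) (t : List (Fin n)) (vt-distinct : distinct (v ∷ t) ≡ true) where

  private
    c = pathConstraint v t
    occ = λ i → count (_== i) t

  hasDegrees-following : ∀ f → respects c f ≡ true →
                         hasDegrees d f ≡ ⋀ᶠ.⨁ (λ i → (occ i + freeFibre c f i) ≡ᵇ d i)
  hasDegrees-following f respects-c = trans (hasDegrees-fibre d f) (⋀ᶠ.⨁-cong λ i →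
    cong (_≡ᵇ d i) (trans (fibre-split c f respects-c i)
                          (cong (_+ freeFibre c f i) (prescribedFibre-path v t vt-distinct i))))

  #following-feasible : Σᶠ.⨁ d ≡ n → (occ≤d : ∀ i → occ i ≤ d i) →
                        #following d v t * factorials (λ i → d i ∸ occ i) ≡ (n ∸ length t) !
  #following-feasible Σd≡n occ≤d = begin
    #following d v t * factorials r  ≡⟨ cong (_* factorials r) (count-cong as-fits (allFuns n n)) ⟩
    count (fits c r) (allFuns n n) * factorials r
                                     ≡⟨ multinomial n c r Σr≡#free ⟩
    #free c !                        ≡⟨ cong _! #free≡ ⟩
    (n ∸ length t) !                 ∎
    where
      open ≡-Reasoning
      r = λ i → d i ∸ occ i
      as-fits : ∀ f → hasDegrees d f ∧ follows f v t ≡ fits c r f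
      as-fits f rewrite sym (respects-path f v t vt-distinct) with respects c f in respects-c
      ... | false = ∧-zeroʳ (hasDegrees d f)
      ... | true  = trans (∧-identityʳ (hasDegrees d f)) (trans (hasDegrees-following f respects-c)
                      (⋀ᶠ.⨁-cong λ i → ≡ᵇ-∸ (occ i) (freeFibre c f i) (d i) (occ≤d i)))
      #free+length : #free c + length t ≡ n
      #free+length = #free-path v t vt-distinct
      #free≡ : #free c ≡ n ∸ length t
      #free≡ = trans (sym (m+n∸n≡m (#free c) (length t))) (cong (_∸ length t) #free+length)
      Σr≡#free : Σᶠ.⨁ r ≡ #free c
      Σr≡#free = +-cancelʳ-≡ (length t) (Σᶠ.⨁ r) (#free c) (begin
        Σᶠ.⨁ r + length t                  ≡⟨ cong (Σᶠ.⨁ r +_) (sym (occurrences-total t)) ⟩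
        Σᶠ.⨁ r + Σᶠ.⨁ occ                  ≡⟨ sym (Σᶠ.⨁-distrib r occ) ⟩
        Σᶠ.⨁ (λ i → r i + occ i)           ≡⟨ Σᶠ.⨁-cong (λ i → m∸n+n≡m (occ≤d i)) ⟩
        Σᶠ.⨁ d                             ≡⟨ trans Σd≡n (sym #free+length) ⟩
        #free c + length t                 ∎)

  #following-overfull : ∀ i → d i < occ i → #following d v t ≡ 0
  #following-overfull i di<occ = trans (count-cong never (allFuns n n)) (∑-0 (allFuns n n))
    where
      never : ∀ f → hasDegrees d f ∧ follows f v t ≡ false
      never f rewrite sym (respects-path f v t vt-distinct) with respects c f in respects-c
      ... | false = ∧-zeroʳ (hasDegrees d f)
      ... | true  = trans (∧-identityʳ (hasDegrees d f)) (trans (hasDegrees-following f respects-c)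
                      (⋀ᶠ-false _ i (<⇒+≡ᵇ-false (freeFibre c f i) di<occ)))

-- Orbits and the six-length

path : ∀ {n} → (Fin n → Fin n) → Fin n → ℕ → List (Fin n)
path f x zero    = []
path f x (suc k) = f x ∷ path f (f x) k

count-follows : ∀ {n} (f : Fin n → Fin n) (P : List (Fin n) → Bool) x k →
                count (λ t → follows f x t ∧ P t) (tuples n k) ≡ 𝟙 (P (path f x k))
count-follows f P x zero    = +-identityʳ (𝟙 (P []))
count-follows {n} f P x (suc k) = begin
  count (λ t → follows f x t ∧ P t) (tuples n (suc k))
    ≡⟨ count-concatMap-map (λ t → follows f x t ∧ P t) (λ i → i ∷_) Tₖ ⟩
  Σᶠ.⨁ (λ i → count (λ t → ((i == f x) ∧ follows f i t) ∧ P (i ∷ t)) Tₖ)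
    ≡⟨ Σᶠ.⨁-cong (λ i → trans (count-cong (λ t → ∧-assoc (i == f x) (follows f i t) (P (i ∷ t))) Tₖ)
                              (trans (count-∧ (i == f x) (λ t → follows f i t ∧ P (i ∷ t)) Tₖ)
                                     (cong (λ b → 𝟙 b * _) (==-sym i (f x))))) ⟩
  Σᶠ.⨁ (λ i → 𝟙 (f x == i) * count (λ t → follows f i t ∧ P (i ∷ t)) Tₖ)
    ≡⟨ Σᶠ-δ (f x) (λ i → count (λ t → follows f i t ∧ P (i ∷ t)) Tₖ) ⟩
  count (λ t → follows f (f x) t ∧ P (f x ∷ t)) Tₖ
    ≡⟨ count-follows f (λ t → P (f x ∷ t)) (f x) k ⟩
  𝟙 (P (path f x (suc k)))
    ∎
  where
    open ≡-Reasoning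
    Tₖ = tuples n k

module _ {A : Set} (p : A → Bool) where

  all-∷ʳ : ∀ xs y → all p (xs ∷ʳ y) ≡ all p xs ∧ p y
  all-∷ʳ []       y = ∧-identityʳ (p y)
  all-∷ʳ (x ∷ xs) y with p x
  ... | true  = all-∷ʳ xs y
  ... | false = refl

  not-any-∷ʳ : ∀ xs y → not (any p (xs ∷ʳ y)) ≡ not (any p xs) ∧ not (p y)
  not-any-∷ʳ []       y = cong not (∨-identityʳ (p y))
  not-any-∷ʳ (x ∷ xs) y with p x
  ... | true  = refl
  ... | false = not-any-∷ʳ xs y

distinct-∷ʳ : ∀ {n} (xs : List (Fin n)) y →
              distinct (xs ∷ʳ y) ≡ distinct xs ∧ all (λ x → not (x == y)) xs
distinct-∷ʳ []       y = refl
distinct-∷ʳ (x ∷ xs) y =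
  trans (cong₂ _∧_ (all-∷ʳ (λ z → not (x == z)) xs y) (distinct-∷ʳ xs y))
        (∧-interchange (all (λ z → not (x == z)) xs) (not (x == y))
                       (distinct xs) (all (λ z → not (z == y)) xs))

all-≢-map : ∀ {n} (a : ℕ → Fin n) y js →
            all (λ x → not (x == y)) (map a js) ≡ not (any (λ j → y == a j) js)
all-≢-map a y []       = refl
all-≢-map a y (j ∷ js) rewrite ==-sym (a j) y with y == a j
... | true  = refl
... | false = all-≢-map a y js

distinct-applyUpTo : ∀ {n} (a : ℕ → Fin n) k →
                     distinct (applyUpTo a (suc k)) ≡
                     not (any (λ k′ → any (λ j → a k′ == a j) (upTo k′)) (applyUpTo suc k))
distinct-applyUpTo a zero    = refl
distinct-applyUpTo a (suc k) = begin
  distinct (applyUpTo a (suc (suc k)))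
    ≡⟨ cong distinct (sym (applyUpTo-∷ʳ a (suc k))) ⟩
  distinct (applyUpTo a (suc k) ∷ʳ a (suc k))
    ≡⟨ distinct-∷ʳ (applyUpTo a (suc k)) (a (suc k)) ⟩
  distinct (applyUpTo a (suc k)) ∧ all (λ x → not (x == a (suc k))) (applyUpTo a (suc k))
    ≡⟨ cong₂ _∧_ (distinct-applyUpTo a k)
                 (trans (cong (all _) (sym (map-applyUpTo id a (suc k))))
                        (all-≢-map a (a (suc k)) (upTo (suc k)))) ⟩
  not (any repeats (applyUpTo suc k)) ∧ not (repeats (suc k))
    ≡⟨ sym (not-any-∷ʳ repeats (applyUpTo suc k) (suc k)) ⟩
  not (any repeats (applyUpTo suc k ∷ʳ suc k))
    ≡⟨ cong (not ∘ any repeats) (applyUpTo-∷ʳ suc k) ⟩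
  not (any repeats (applyUpTo suc (suc k)))
    ∎
  where
    open ≡-Reasoning
    repeats = λ k′ → any (λ j → a k′ == a j) (upTo k′)

path-applyUpTo : ∀ {n} (f : Fin n → Fin n) x k → x ∷ path f x k ≡ applyUpTo (λ j → iter f j x) (suc k)
path-applyUpTo f x zero    = refl
path-applyUpTo f x (suc k) =
  cong (x ∷_) (trans (path-applyUpTo f (f x) k) (applyUpTo-cong iter-shift (suc k)))
  where
    iter-shift : ∀ j → iter f j (f x) ≡ iter f (suc j) x
    iter-shift zero    = refl
    iter-shift (suc j) = cong f (iter-shift j)
    applyUpTo-cong : ∀ {g h : ℕ → Fin _} → (∀ j → g j ≡ h j) → ∀ k → applyUpTo g k ≡ applyUpTo h k
    applyUpTo-cong g≗h zero    = refl
    applyUpTo-cong g≗h (suc k) = cong₂ _∷_ (g≗h 0) (applyUpTo-cong (g≗h ∘ suc) k)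

distinct-path : ∀ {n} (f : Fin n → Fin n) v k → distinct (v ∷ path f v k) ≡ sixLengthGt f v k
distinct-path f v k =
  trans (cong distinct (path-applyUpTo f v k)) (distinct-applyUpTo (λ j → iter f j v) k)

inJ : ∀ {n} → Fin n → List (Fin n) → Bool
inJ v t = all (λ i → not (i == v)) t ∧ distinct t

inJ≡distinct : ∀ {n} (v : Fin n) t → inJ v t ≡ distinct (v ∷ t)
inJ≡distinct v t = cong (λ b → and b ∧ distinct t) (map-cong (λ i → cong not (==-sym i v)) t)

tuples-length : ∀ n k → All (λ t → length t ≡ k) (tuples n k)
tuples-length n zero    = refl ∷ᴬ []ᴬ
tuples-length n (suc k) =
  concat⁺ (map⁺ (All.universal (λ i → map⁺ (All.map (cong suc) (tuples-length n k))) (allFin n)))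

J-members : ∀ {n} k (v : Fin n) → All (λ t → distinct (v ∷ t) ≡ true × length t ≡ k) (J n k v)
J-members {n} k v =
  All.zipWith (λ {t} → member-facts {t}) (all-filter inJ? (tuples n k) , filter⁺ inJ? (tuples-length n k))
  where
    inJ? = T? ∘ inJ v
    member-facts : ∀ {t} → T (inJ v t) × length t ≡ k → distinct (v ∷ t) ≡ true × length t ≡ k
    member-facts {t} (t∈J , t-length) =
      trans (sym (inJ≡distinct v t)) (Equivalence.to T-≡ t∈J) , t-length

count-follows-J : ∀ {n} (f : Fin n → Fin n) v k → count (follows f v) (J n k v) ≡ 𝟙 (sixLengthGt f v k)
count-follows-J {n} f v k =
  trans (count-filterᵇ (inJ v) (follows f v) (tuples n k))
  (trans (count-cong (λ t → ∧-comm (inJ v t) (follows f v t)) (tuples n k))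
  (trans (count-follows f (inJ v) v k)
         (cong 𝟙 (trans (inJ≡distinct v (path f v k)) (distinct-path f v k)))))

module _ {n} (d : Fin n → ℕ) (Σd≡n : Σᶠ.⨁ d ≡ n) (v : Fin n) where

  private
    L = allFuns n n
    |𝔉| = length (𝔉 d)

  |𝔉|-factorials : |𝔉| * factorials d ≡ n !
  |𝔉|-factorials = trans
    (cong (_* factorials d) (trans (length-filterᵇ (hasDegrees d) L)
                                   (count-cong (λ f → sym (∧-identityʳ (hasDegrees d f))) L)))
    (#following-feasible d v [] refl Σd≡n (λ _ → z≤n))

  |𝔉|-nonZero : NonZero |𝔉|
  |𝔉|-nonZero = m*n≢0⇒m≢0 |𝔉| {{subst NonZero (sym |𝔉|-factorials) (n !≢0)}}

  #following-falling : ∀ t → distinct (v ∷ t) ≡ true → length t ≤ n →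
                       #following d v t * falling n (length t) ≡ |𝔉| * product (map d t)
  #following-falling t vt-distinct k≤n with all? (λ i → count (_== i) t ≤? d i)
  ... | yes occ≤d = *-cancelʳ-≡ _ _ (factorials r) {{factorials-nonZero r}} (begin
    #following d v t * F * factorials r  ≡⟨ xy*z≡xz*y (#following d v t) F (factorials r) ⟩
    #following d v t * factorials r * F  ≡⟨ cong (_* F) feasible ⟩
    (n ∸ length t) ! * F                 ≡⟨ falling-factorial n (length t) k≤n ⟩
    n !                                  ≡⟨ sym |𝔉|-factorials ⟩
    |𝔉| * factorials d                   ≡⟨ cong (|𝔉| *_) (factorials-split d t t-distinct occ≤d) ⟩
    |𝔉| * (factorials r * Π)             ≡⟨ x*yz≡xz*y |𝔉| (factorials r) Π ⟩
    |𝔉| * Π * factorials r               ∎)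
    where
      open ≡-Reasoning
      F = falling n (length t)
      Π = product (map d t)
      r = λ i → d i ∸ count (_== i) t
      t-distinct = distinct-tail v t vt-distinct
      feasible = #following-feasible d v t vt-distinct Σd≡n occ≤d
  ... | no ¬occ≤d with ¬∀⟶∃¬ n _ (λ i → count (_== i) t ≤? d i) ¬occ≤d
  ...   | i , occᵢ≰dᵢ = begin
    #following d v t * falling n (length t)  ≡⟨ cong (_* falling n (length t)) following≡0 ⟩
    0                                        ≡⟨ sym (*-zeroʳ |𝔉|) ⟩
    |𝔉| * 0                                  ≡⟨ cong (|𝔉| *_) (sym product≡0) ⟩
    |𝔉| * product (map d t)                  ∎
    where
      open ≡-Reasoning
      following≡0 = #following-overfull d v t vt-distinct i (≰⇒> occᵢ≰dᵢ)
      product≡0 = product-overfull d t (distinct-tail v t vt-distinct) i (≰⇒> occᵢ≰dᵢ)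

  #sixLengthGt≡∑#following : ∀ k → length (filterᵇ (λ f → sixLengthGt f v k) (𝔉 d)) ≡
                                   ∑ (#following d v) (J n k v)
  #sixLengthGt≡∑#following k = sym (begin
    ∑ (#following d v) (J n k v)
      ≡⟨ ∑-comm (λ t f → 𝟙 (hasDegrees d f ∧ follows f v t)) (J n k v) L ⟩
    ∑ (λ f → count (λ t → hasDegrees d f ∧ follows f v t) (J n k v)) L
      ≡⟨ ∑-cong (λ f → count-∧ (hasDegrees d f) (follows f v) (J n k v)) L ⟩
    ∑ (λ f → 𝟙 (hasDegrees d f) * count (follows f v) (J n k v)) L
      ≡⟨ ∑-cong (λ f → trans (cong (𝟙 (hasDegrees d f) *_) (count-follows-J f v k))
                            (sym (𝟙-∧ (hasDegrees d f) (sixLengthGt f v k)))) L ⟩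
    count (λ f → hasDegrees d f ∧ sixLengthGt f v k) L
      ≡⟨ sym (count-filterᵇ (hasDegrees d) (λ f → sixLengthGt f v k) L) ⟩
    count (λ f → sixLengthGt f v k) (𝔉 d)
      ≡⟨ sym (length-filterᵇ (λ f → sixLengthGt f v k) (𝔉 d)) ⟩
    length (filterᵇ (λ f → sixLengthGt f v k) (𝔉 d))
      ∎)
    where open ≡-Reasoning

  #sixLengthGt-falling : ∀ k → k ≤ n →
    length (filterᵇ (λ f → sixLengthGt f v k) (𝔉 d)) * falling n k ≡ |𝔉| * Jsum d k v
  #sixLengthGt-falling k k≤n = begin
    length (filterᵇ (λ f → sixLengthGt f v k) (𝔉 d)) * falling n k
      ≡⟨ cong (_* falling n k) (#sixLengthGt≡∑#following k) ⟩
    ∑ (#following d v) (J n k v) * falling n k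
      ≡⟨ sym (∑-*ʳ (falling n k) (#following d v) (J n k v)) ⟩
    ∑ (λ t → #following d v t * falling n k) (J n k v)
      ≡⟨ ∑-cong-All (All.map (λ {t} → per-path {t}) (J-members k v)) ⟩
    ∑ (λ t → |𝔉| * product (map d t)) (J n k v)
      ≡⟨ ∑-*ˡ |𝔉| (λ t → product (map d t)) (J n k v) ⟩
    |𝔉| * Jsum d k v
      ∎
    where
      open ≡-Reasoning
      per-path : ∀ {t} → distinct (v ∷ t) ≡ true × length t ≡ k →
                 #following d v t * falling n k ≡ |𝔉| * product (map d t)
      per-path {t} (vt-distinct , refl) = #following-falling t vt-distinct k≤n

lemma3p2 : (n : ℕ) → 2 ≤ n → (d : Fin n → ℕ) → sum (map d (allFin n)) ≡ n →
           (v : Fin n) → (k : ℕ) → 1 ≤ k → k ≤ n ∸ 1 →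
           probSixLengthGt d v k ≡ ratio (Jsum d k v) (falling n k)
lemma3p2 n _ d Σd≡n v k _ k≤n-1 =
  ratio-cross _ _ _ _ {{|𝔉|-nonZero d Σᶠd≡n v}} {{falling-nonZero n k k≤n}}
    (trans (#sixLengthGt-falling d Σᶠd≡n v k k≤n) (*-comm (length (𝔉 d)) (Jsum d k v)))
  where
    Σᶠd≡n = trans (sym (Σᶠ.foldr-map-allFin d)) Σd≡n
    k≤n = ≤-trans k≤n-1 (m∸n≤m n 1)
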